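{- Let $\Gamma$ be a program (possibly with aggregate expressions in rule bodies). The stable models of $\Gamma$ are exactly the stable models of the infinitary program $\tau_1\Gamma$ that satisfy $\tau_2\Gamma$.
   Context: Terms are built from numerals $\overline n$ ($n\in\mathbb Z$), symbolic constants, variables, $\mathit{inf},\mathit{sup}$, $f(\mathbf t)$ ($f$ a symbolic constant), $\mathit{op}(\mathbf t)$ (each $n$-ary operation name has a function $\widehat{\mathit{op}}$ from a subset of $\mathbb Z^n$ to $\mathbb Z$), and intervals $(t_1..t_2)$. Ground = variable-free; precomputed = ground without operation names or intervals. A total order on precomputed terms ($\mathit{inf}$ least, $\mathit{sup}$ greatest, numerals ordered as integers) interprets $=,\neq,<,>,\le,\ge$. Values $[t]$ of ground terms: $\{t\}$ for numerals, symbolic constants, $\mathit{inf},\mathit{sup}$; $[f(t_1,..,t_n)]=\{f(r_1,..,r_n):r_i\in[t_i]\}$; $[\mathit{op}(t_1,..,t_n)]=\{\overline{\widehat{\mathit{op}}(k_1,..,k_n)}:(k_i)\in\mathrm{dom}\,\widehat{\mathit{op}},\overline{k_i}\in[t_i]\}$; $[(t_1..t_2)]=\{\overline m:k_1\le m\le k_2,\overline{k_1}\in[t_1],\overline{k_2}\in[t_2]\}$; $[t_1,..,t_n]$ = tuples of values. Literals: atoms $p(\mathbf t)$ or $\mathit{not}\ p(\mathbf t)$; comparisons $(t_1\prec t_2)$. Each aggregate name $\alpha$ has a function $\widehat\alpha$ from sets of non-empty tuples of precomputed terms to precomputed terms. Aggregate expressions: $\alpha\{\mathbf t:\mathbf C\}\prec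 s$ ($\mathbf t$ non-empty, $\mathbf C$ a conjunction of literals and comparisons, $s$ a variable or precomputed term), closed if $s$ is ground. A rule is $\mathit{Head}\leftarrow\mathit{Body}$, $\mathit{Body}$ a conjunction of literals, comparisons and aggregate expressions, $\mathit{Head}$ an atom (basic rule), $\{A\}$ for an atom $A$ (choice rule), or empty (constraint); a program is a set of rules. A variable of a rule is local if all its occurrences are inside the part $\alpha\{\mathbf t:\mathbf C\}$ of aggregate expressions in the body, else global. A rule is closed if all its variables are local; an instance of a rule is the closed rule obtained by substituting precomputed terms for its global variables. The vocabulary of $\Gamma$: atoms $p(\mathbf r)$ with $\mathbf r$ an $n$-tuple of precomputed terms such that $\Gamma$ contains some atom $p(t_1,..,t_n)$. Infinitary formulas over the vocabulary: atoms, $\bot$, $\mathcal H^\wedge$, $\mathcal H^\vee$ for arbitrary sets $\mathcal H$, $G\to H$; $\neg F=F\to\bot$, $\top=\neg\bot$; classical satisfaction. Reduct: $F^{\mathcal I}=\bot$ if $\mathcal I\not\models F$; otherwise $A^{\mathcal I}=A$, $(\mathcal H^\wedge)^{\mathcal I}=\{G^{\mathcal I}:G\in\mathcal H\}^\wedge$, similarly for $\vee$, $(G\to H)^{\mathcal I}=G^{\mathcal I}\to H^{\mathcal I}$. $\mathcal I$ is a stable model of $F$ if it is an inclusion-minimal set of atoms satisfying $F^{\mathcal I}$. An infinitary program is a conjunction of infinitary rules $F\to A$ ($A$ an atom), with stable models as for any infinitary formula. Translation $\tau$: $\tau p(\mathbf t)=\bigvee_{\mathbf r\in[\mathbf t]}p(\mathbf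 r)$, $\tau(\mathit{not}\ p(\mathbf t))=\bigvee_{\mathbf r\in[\mathbf t]}\neg p(\mathbf r)$ (ground); $\tau(t_1\prec t_2)$ is $\top$ if $r_1\prec r_2$ for some $r_i\in[t_i]$, else $\bot$. For a closed aggregate expression $E=\alpha\{\mathbf t:\mathbf C\}\prec s$ with variable list $\mathbf X$, $A$ the tuples of precomputed terms of length $|\mathbf X|$, $[\Delta]=\bigcup_{\mathbf r\in\Delta}[\mathbf t^{\mathbf X}_{\mathbf r}]$, $\Delta$ justifying $E$ iff $\widehat\alpha([\Delta])\prec s$: $\tau E$ is the conjunction over non-justifying $\Delta\subseteq A$ of $\bigwedge_{\mathbf r\in\Delta}\tau(\mathbf C^{\mathbf X}_{\mathbf r})\to\bigvee_{\mathbf r\in A\setminus\Delta}\tau(\mathbf C^{\mathbf X}_{\mathbf r})$. $\tau$ is conjunct-wise on conjunctions. Closed rules: $\tau(p(\mathbf t)\leftarrow\mathit{Body})=\tau(\mathit{Body})\to\bigwedge_{\mathbf r\in[\mathbf t]}p(\mathbf r)$; $\tau(\{p(\mathbf t)\}\leftarrow\mathit{Body})=\tau(\mathit{Body})\to\bigwedge_{\mathbf r\in[\mathbf t]}(p(\mathbf r)\vee\neg p(\mathbf r))$; $\tau(\leftarrow\mathit{Body})=\neg\tau(\mathit{Body})$. $\tau\Gamma$ is the conjunction of $\tau R$ over all instances $R$ of rules of $\Gamma$; the stable models of $\Gamma$ are the stable models of $\tau\Gamma$. $\tau_1\Gamma$ is the conjunction of the infinitary rules $\tau(\mathit{Body})\to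 p(\mathbf r)$ for all instances $p(\mathbf t)\leftarrow\mathit{Body}$ of basic rules of $\Gamma$ and all $\mathbf r\in[\mathbf t]$, and $\tau(\mathit{Body})\wedge\neg\neg p(\mathbf r)\to p(\mathbf r)$ for all instances $\{p(\mathbf t)\}\leftarrow\mathit{Body}$ of choice rules of $\Gamma$ and all $\mathbf r\in[\mathbf t]$. $\tau_2\Gamma$ is the conjunction of $\neg\tau\mathbf C$ over all instances $\leftarrow\mathbf C$ of constraints of $\Gamma$. -}

module Defs where

open import Data.Nat as ℕ using (ℕ)
open import Data.Integer as ℤ using (ℤ)
open import Data.Bool using (Bool; true; false; if_then_else_)
open import Data.Maybe using (Maybe; just; nothing; maybe)
open import Data.List using (List; []; _∷_; _++_; length; lookup; deduplicate; concatMap)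
open import Data.List.Relation.Unary.Any using (Any)
open import Data.List.Membership.DecPropositional ℕ._≟_ using (_∈?_)
open import Data.Vec as Vec using (Vec)
open import Data.Fin using (Fin)
open import Data.Product using (Σ; _×_; _,_; proj₁)
open import Data.Unit using (⊤; tt)
open import Data.Empty using (⊥)
open import Data.Sum using (_⊎_)
open import Relation.Nullary using (¬_; does)
open import Relation.Binary using (IsStrictTotalOrder)
open import Relation.Binary.PropositionalEquality using (_≡_; _≢_)
open import Function.Bundles using (_⇔_)

Var : Set
Var = ℕ

data PTerm (Sym : Set) : Set where
  pnum : ℤ → PTerm Sym
  psym : Sym → PTerm Sym
  pinf : PTerm Sym
  psup : PTerm Sym
  papp : Sym → List (PTerm Sym) → PTerm Sym

record Signature : Set₁ where
  field
    Sym      : Set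
    PredName : Set
    OpName   : Set
    arity    : OpName → ℕ
    opDom    : (o : OpName) → Vec ℤ (arity o) → Set
    opFun    : (o : OpName) (ks : Vec ℤ (arity o)) → opDom o ks → ℤ
    AggName  : Set
    -- α̂ maps sets of tuples of precomputed terms to precomputed terms
    aggFun   : AggName → (List (PTerm Sym) → Set) → PTerm Sym
    _<ₚ_       : PTerm Sym → PTerm Sym → Set
    <ₚ-sto     : IsStrictTotalOrder _≡_ _<ₚ_
    inf-least  : ∀ r → r ≢ pinf → pinf <ₚ r
    sup-great  : ∀ r → r ≢ psup → r <ₚ psup
    num-order  : ∀ m n → (pnum m <ₚ pnum n) ⇔ (m ℤ.< n)

module Lang (S : Signature) where
  open Signature S

  PT : Set
  PT = PTerm Sym

  data Term : Set where
    num  : ℤ → Term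
    sym  : Sym → Term
    var  : Var → Term
    inf  : Term
    sup  : Term
    fn   : Sym → List Term → Term
    op   : (o : OpName) → Vec Term (arity o) → Term
    intv : Term → Term → Term

  mutual
    emb : PT → Term
    emb (pnum n) = num n
    emb (psym c) = sym c
    emb pinf = inf
    emb psup = sup
    emb (papp f rs) = fn f (embs rs)

    embs : List PT → List Term
    embs [] = []
    embs (r ∷ rs) = emb r ∷ embs rs

  -- Values of (ground) terms, as membership predicates:  r ∈V t  means r ∈ [t].
  mutual
    _∈V_ : PT → Term → Set
    r ∈V num n = r ≡ pnum n
    r ∈V sym c = r ≡ psym c
    r ∈V var x = ⊥
    r ∈V inf = r ≡ pinf
    r ∈V sup = r ≡ psup
    r ∈V fn f ts = Σ (List PT) λ rs → (r ≡ papp f rs) × (rs ∈Vs ts)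
    r ∈V op o ts = Σ (Vec ℤ (arity o)) λ ks → Σ (opDom o ks) λ d →
                     (r ≡ pnum (opFun o ks d)) × (ks ∈Zs ts)
    r ∈V intv t₁ t₂ = Σ ℤ λ m → Σ ℤ λ k₁ → Σ ℤ λ k₂ →
                     (r ≡ pnum m) × (k₁ ℤ.≤ m) × (m ℤ.≤ k₂) ×
                     (pnum k₁ ∈V t₁) × (pnum k₂ ∈V t₂)

    _∈Vs_ : List PT → List Term → Set
    [] ∈Vs [] = ⊤
    (r ∷ rs) ∈Vs (t ∷ ts) = (r ∈V t) × (rs ∈Vs ts)
    [] ∈Vs (_ ∷ _) = ⊥
    (_ ∷ _) ∈Vs [] = ⊥

    _∈Zs_ : ∀ {n} → Vec ℤ n → Vec Term n → Set
    Vec.[] ∈Zs Vec.[] = ⊤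
    (k Vec.∷ ks) ∈Zs (t Vec.∷ ts) = (pnum k ∈V t) × (ks ∈Zs ts)

  Sub : Set
  Sub = Var → Maybe PT

  mutual
    sT : Sub → Term → Term
    sT σ (num n) = num n
    sT σ (sym c) = sym c
    sT σ (var x) = maybe emb (var x) (σ x)
    sT σ inf = inf
    sT σ sup = sup
    sT σ (fn f ts) = fn f (sTs σ ts)
    sT σ (op o ts) = op o (sTv σ ts)
    sT σ (intv t₁ t₂) = intv (sT σ t₁) (sT σ t₂)

    sTs : Sub → List Term → List Term
    sTs σ [] = []
    sTs σ (t ∷ ts) = sT σ t ∷ sTs σ ts

    sTv : ∀ {n} → Sub → Vec Term n → Vec Term n
    sTv σ Vec.[] = Vec.[]
    sTv σ (t Vec.∷ ts) = sT σ t Vec.∷ sTv σ ts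

  mutual
    vT : Term → List Var
    vT (num n) = []
    vT (sym c) = []
    vT (var x) = x ∷ []
    vT inf = []
    vT sup = []
    vT (fn f ts) = vTs ts
    vT (op o ts) = vTv ts
    vT (intv t₁ t₂) = vT t₁ ++ vT t₂

    vTs : List Term → List Var
    vTs [] = []
    vTs (t ∷ ts) = vT t ++ vTs ts

    vTv : ∀ {n} → Vec Term n → List Var
    vTv Vec.[] = []
    vTv (t Vec.∷ ts) = vT t ++ vTv ts

  record SAtom : Set where
    constructor _⦅_⦆
    field
      pred : PredName
      args : List Term
  open SAtom public

  data Lit : Set where
    pos : SAtom → Lit
    neg : SAtom → Lit

  data Rel : Set where
    eq neq lt gt le ge : Rel

  data CElem : Set where
    lit : Lit → CElem
    cmp : Rel → Term → Term → CElem

  data Bound : Set where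
    bvar : Var → Bound
    bpre : PT → Bound

  -- body elements; agg α t ts C ≺ s  is  α{t,ts : C} ≺ s  (tuple non-empty)
  data BElem : Set where
    cond : CElem → BElem
    agg  : AggName → Term → List Term → List CElem → Rel → Bound → BElem

  data Head : Set where
    basic  : SAtom → Head
    choice : SAtom → Head
    none   : Head

  record Rule : Set where
    constructor _⇐_
    field
      head : Head
      body : List BElem
  open Rule public

  Program : Set₁
  Program = Rule → Set

  sA : Sub → SAtom → SAtom
  sA σ (p ⦅ ts ⦆) = p ⦅ sTs σ ts ⦆

  sL : Sub → Lit → Lit
  sL σ (pos a) = pos (sA σ a)
  sL σ (neg a) = neg (sA σ a)

  sC : Sub → CElem → CElem
  sC σ (lit l) = lit (sL σ l)
  sC σ (cmp ≺ t₁ t₂) = cmp ≺ (sT σ t₁) (sT σ t₂)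

  sCs : Sub → List CElem → List CElem
  sCs σ [] = []
  sCs σ (c ∷ cs) = sC σ c ∷ sCs σ cs

  sBd : Sub → Bound → Bound
  sBd σ (bvar x) = maybe bpre (bvar x) (σ x)
  sBd σ (bpre r) = bpre r

  sB : Sub → BElem → BElem
  sB σ (cond c) = cond (sC σ c)
  sB σ (agg α t ts cs ≺ s) = agg α (sT σ t) (sTs σ ts) (sCs σ cs) ≺ (sBd σ s)

  sBs : Sub → List BElem → List BElem
  sBs σ [] = []
  sBs σ (b ∷ bs) = sB σ b ∷ sBs σ bs

  sH : Sub → Head → Head
  sH σ (basic a) = basic (sA σ a)
  sH σ (choice a) = choice (sA σ a)
  sH σ none = none

  vA : SAtom → List Var
  vA (p ⦅ ts ⦆) = vTs ts

  vC : CElem → List Var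
  vC (lit (pos a)) = vA a
  vC (lit (neg a)) = vA a
  vC (cmp ≺ t₁ t₂) = vT t₁ ++ vT t₂

  vCs : List CElem → List Var
  vCs [] = []
  vCs (c ∷ cs) = vC c ++ vCs cs

  vBd : Bound → List Var
  vBd (bvar x) = x ∷ []
  vBd (bpre r) = []

  vBglob : BElem → List Var
  vBglob (cond c) = vC c
  vBglob (agg α t ts cs ≺ s) = vBd s

  vH : Head → List Var
  vH (basic a) = vA a
  vH (choice a) = vA a
  vH none = []

  globals : Rule → List Var
  globals (h ⇐ bs) = vH h ++ concatMap vBglob bs

  inst : (Var → PT) → Rule → Rule
  inst θ R = sH σ (head R) ⇐ sBs σ (body R)
    where
      σ : Sub
      σ x = if does (x ∈? globals R) then just (θ x) else nothing

  atC : CElem → List SAtom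
  atC (lit (pos a)) = a ∷ []
  atC (lit (neg a)) = a ∷ []
  atC (cmp _ _ _) = []

  atB : BElem → List SAtom
  atB (cond c) = atC c
  atB (agg α t ts cs ≺ s) = concatMap atC cs

  atH : Head → List SAtom
  atH (basic a) = a ∷ []
  atH (choice a) = a ∷ []
  atH none = []

  atR : Rule → List SAtom
  atR (h ⇐ bs) = atH h ++ concatMap atB bs

  GAtom : Set
  GAtom = PredName × List PT

  Interp : Set
  Interp = GAtom → Bool

  _⊆_ : Interp → Interp → Set
  J ⊆ I = ∀ a → J a ≡ true → I a ≡ true

  Voc : Program → GAtom → Set
  Voc Γ (p , rs) = Σ Rule λ R → Γ R ×
                   Any (λ a → (pred a ≡ p) × (length (args a) ≡ length rs)) (atR R)

  InVoc : Program → Interp → Set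
  InVoc Γ I = ∀ a → I a ≡ true → Voc Γ a

  data Form : Set₁ where
    atom : GAtom → Form
    ⊥'   : Form
    ⋀    : (H : Set) → (H → Form) → Form
    ⋁    : (H : Set) → (H → Form) → Form
    _⇒_  : Form → Form → Form

  ¬' : Form → Form
  ¬' F = F ⇒ ⊥'

  ⊤' : Form
  ⊤' = ¬' ⊥'

  _∧'_ : Form → Form → Form
  F ∧' G = ⋀ Bool (λ b → if b then F else G)

  _∨'_ : Form → Form → Form
  F ∨' G = ⋁ Bool (λ b → if b then F else G)

  _⊨_ : Interp → Form → Set
  I ⊨ atom a = I a ≡ true
  I ⊨ ⊥' = ⊥
  I ⊨ ⋀ H f = ∀ i → I ⊨ f i
  I ⊨ ⋁ H f = Σ H λ i → I ⊨ f i
  I ⊨ (F ⇒ G) = I ⊨ F → I ⊨ G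

  -- J ⊨ F^I  (satisfaction of the reduct F^I by J), unfolded:
  -- F^I = ⊥ if I ⊭ F; otherwise the reduct is taken componentwise.
  Red : Interp → Interp → Form → Set
  Red J I (atom a) = (I ⊨ atom a) × (J a ≡ true)
  Red J I ⊥' = (I ⊨ ⊥') × ⊥
  Red J I (⋀ H f) = (I ⊨ ⋀ H f) × (∀ i → Red J I (f i))
  Red J I (⋁ H f) = (I ⊨ ⋁ H f) × (Σ H λ i → Red J I (f i))
  Red J I (F ⇒ G) = (I ⊨ (F ⇒ G)) × (Red J I F → Red J I G)

  StableModel : Form → Interp → Set
  StableModel F I = Red I I F × (∀ J → J ⊆ I → Red J I F → I ⊆ J)

  _⟦_⟧_ : PT → Rel → PT → Set
  r₁ ⟦ eq ⟧ r₂ = r₁ ≡ r₂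
  r₁ ⟦ neq ⟧ r₂ = ¬ (r₁ ≡ r₂)
  r₁ ⟦ lt ⟧ r₂ = r₁ <ₚ r₂
  r₁ ⟦ gt ⟧ r₂ = r₂ <ₚ r₁
  r₁ ⟦ le ⟧ r₂ = (r₁ <ₚ r₂) ⊎ (r₁ ≡ r₂)
  r₁ ⟦ ge ⟧ r₂ = (r₂ <ₚ r₁) ⊎ (r₁ ≡ r₂)

  τA : SAtom → Form
  τA (p ⦅ ts ⦆) = ⋁ (Σ (List PT) λ rs → rs ∈Vs ts) λ r → atom (p , proj₁ r)

  τnA : SAtom → Form
  τnA (p ⦅ ts ⦆) = ⋁ (Σ (List PT) λ rs → rs ∈Vs ts) λ r → ¬' (atom (p , proj₁ r))

  τC : CElem → Form
  τC (lit (pos a)) = τA a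
  τC (lit (neg a)) = τnA a
  τC (cmp ≺ t₁ t₂) =
    ⋁ (Σ PT λ r₁ → Σ PT λ r₂ → (r₁ ∈V t₁) × (r₂ ∈V t₂) × (r₁ ⟦ ≺ ⟧ r₂)) (λ _ → ⊤')

  τCs : List CElem → Form
  τCs cs = ⋀ (Fin (length cs)) (λ i → τC (lookup cs i))

  asg : (X : List Var) → Vec PT (length X) → Sub
  asg [] Vec.[] x = nothing
  asg (y ∷ ys) (r Vec.∷ rs) x = if does (x ℕ.≟ y) then just r else asg ys rs x

  τAgg : AggName → Term → List Term → List CElem → Rel → PT → Form
  τAgg α t ts cs ≺ s =
    ⋀ (Σ (A → Bool) λ Δ → ¬ (aggFun α (val Δ) ⟦ ≺ ⟧ s)) λ where
      (Δ , _) → (⋀ (Σ A λ r → Δ r ≡ true)  λ rr → τCs (Cr (proj₁ rr)))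
              ⇒ (⋁ (Σ A λ r → Δ r ≡ false) λ rr → τCs (Cr (proj₁ rr)))
    where
      X : List Var
      X = deduplicate ℕ._≟_ (vTs (t ∷ ts) ++ vCs cs)
      A : Set
      A = Vec PT (length X)
      Cr : A → List CElem
      Cr r = sCs (asg X r) cs
      val : (A → Bool) → List PT → Set
      val Δ u = Σ A λ r → (Δ r ≡ true) × (u ∈Vs sTs (asg X r) (t ∷ ts))

  τB : BElem → Form
  τB (cond c) = τC c
  τB (agg α t ts cs ≺ (bpre s)) = τAgg α t ts cs ≺ s
  τB (agg α t ts cs ≺ (bvar x)) = ⊥'   -- not closed; never arises for instances

  τBody : List BElem → Form
  τBody bs = ⋀ (Fin (length bs)) (λ i → τB (lookup bs i))

  τR : Rule → Form
  τR (basic (p ⦅ ts ⦆) ⇐ bs) =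
    τBody bs ⇒ ⋀ (Σ (List PT) λ rs → rs ∈Vs ts) (λ r → atom (p , proj₁ r))
  τR (choice (p ⦅ ts ⦆) ⇐ bs) =
    τBody bs ⇒ ⋀ (Σ (List PT) λ rs → rs ∈Vs ts)
                 (λ r → atom (p , proj₁ r) ∨' ¬' (atom (p , proj₁ r)))
  τR (none ⇐ bs) = ¬' (τBody bs)

  InstIdx : Program → Set
  InstIdx Γ = Σ Rule Γ × (Var → PT)

  instOf : {Γ : Program} → InstIdx Γ → Rule
  instOf ((R , _) , θ) = inst θ R

  τΓ : Program → Form
  τΓ Γ = ⋀ (InstIdx Γ) (λ k → τR (instOf {Γ} k))

  HeadIdx : Head → Set
  HeadIdx (basic (p ⦅ ts ⦆)) = Σ (List PT) λ rs → rs ∈Vs ts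
  HeadIdx (choice (p ⦅ ts ⦆)) = Σ (List PT) λ rs → rs ∈Vs ts
  HeadIdx none = ⊥

  τ₁comp : (h : Head) → List BElem → HeadIdx h → Form
  τ₁comp (basic (p ⦅ ts ⦆)) bs (rs , _) = τBody bs ⇒ atom (p , rs)
  τ₁comp (choice (p ⦅ ts ⦆)) bs (rs , _) =
    (τBody bs ∧' ¬' (¬' (atom (p , rs)))) ⇒ atom (p , rs)

  τ₁ : Program → Form
  τ₁ Γ = ⋀ (Σ (InstIdx Γ) λ k → HeadIdx (head (instOf {Γ} k)))
           (λ where (k , i) → τ₁comp (head (instOf {Γ} k)) (body (instOf {Γ} k)) i)

  IsConstraint : Head → Set
  IsConstraint none = ⊤
  IsConstraint (basic _) = ⊥
  IsConstraint (choice _) = ⊥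

  τ₂ : Program → Form
  τ₂ Γ = ⋀ (Σ (InstIdx Γ) λ k → IsConstraint (head (instOf {Γ} k)))
           (λ where (k , _) → ¬' (τBody (body (instOf {Γ} k))))

  StableModelΓ : Program → Interp → Set
  StableModelΓ Γ I = InVoc Γ I × StableModel (τΓ Γ) I

module Submission where

open import Defs
open import Data.Bool using (Bool; true; false; if_then_else_)
import Data.Bool.Properties as Bool
open import Data.Empty using (⊥-elim)
open import Data.Product using (Σ; _×_; _,_; proj₁; proj₂)
open import Data.Product.Function.NonDependent.Propositional using (_×-⇔_)
open import Data.Unit using (tt)
open import Function.Bundles using (_⇔_; mk⇔; Equivalence)
open import Function.Properties.Equivalence using () renaming (refl to ⇔-refl)
open import Relation.Nullary using (Dec; yes; no)
open import Relation.Nullary.Decidable using (decidable-stable)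

-- The reduct J ⊨ F^I carries I ⊨ F at every node, so once I is fixed the
-- rule-by-rule rewriting of τ into τ₁ and τ₂ preserves the reducts for
-- every J at once: a choice rule B → A ∨ ¬A and the rule B ∧ ¬¬A → A have
-- the same reducts because A is decidable in I, and a constraint ¬B has
-- reduct ⊤ or ⊥ according to I alone, so it contributes only I ⊨ ¬B.
-- Equal reducts give equal stable models.

module _ (S : Signature) where
  open Lang S
  open Equivalence

  atom? : ∀ (I : Interp) a → Dec (I ⊨ atom a)
  atom? I a = I a Bool.≟ true

  atom-excluded-middle : ∀ (I : Interp) a → I ⊨ (atom a ∨' ¬' (atom a))
  atom-excluded-middle I a with atom? I a
  ... | yes Ia = true , Ia
  ... | no ¬Ia = false , ¬Ia

  module _ {J I : Interp} where

    Red⇒⊨ : ∀ F → Red J I F → I ⊨ F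
    Red⇒⊨ (atom _) = proj₁
    Red⇒⊨ ⊥'       = proj₁
    Red⇒⊨ (⋀ _ _)  = proj₁
    Red⇒⊨ (⋁ _ _)  = proj₁
    Red⇒⊨ (_ ⇒ _)  = proj₁

    Red-⋀ : ∀ {H} (f : H → Form) → Red J I (⋀ H f) ⇔ (∀ i → Red J I (f i))
    Red-⋀ f = mk⇔ proj₂ (λ r → (λ i → Red⇒⊨ (f i) (r i)) , r)

    Red-¬ : ∀ F → Red J I (¬' F) ⇔ (I ⊨ ¬' F)
    Red-¬ F = mk⇔ proj₁ (λ ¬F → ¬F , λ r → ⊥-elim (¬F (Red⇒⊨ F r)))

    Red-⇒⋀ : ∀ F {H} (f : H → Form) →
             Red J I (F ⇒ ⋀ H f) ⇔ (∀ i → Red J I (F ⇒ f i))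
    Red-⇒⋀ F f = mk⇔
      (λ (F⇒f , r) i → (λ IF → F⇒f IF i) , (λ rF → proj₂ (r rF) i))
      (λ r → (λ IF i → proj₁ (r i) IF)
           , λ rF → (λ i → proj₁ (r i) (Red⇒⊨ F rF)) , λ i → proj₂ (r i) rF)

    Red-choice : ∀ F a →
                 Red J I (F ⇒ (atom a ∨' ¬' (atom a))) ⇔
                 Red J I ((F ∧' ¬' (¬' (atom a))) ⇒ atom a)
    Red-choice F a = mk⇔ to′ from′
      where
        stable : I ⊨ ¬' (¬' (atom a)) → I ⊨ atom a
        stable = decidable-stable (atom? I a)

        to′ : Red J I (F ⇒ (atom a ∨' ¬' (atom a))) →
              Red J I ((F ∧' ¬' (¬' (atom a))) ⇒ atom a)
        to′ (_ , r) = (λ IF¬¬a → stable (IF¬¬a false)) , λ (_ , rF¬¬a) →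
          Red-∨¬⇒atom (r (rF¬¬a true)) (stable (proj₁ (rF¬¬a false)))
          where
            Red-∨¬⇒atom : Red J I (atom a ∨' ¬' (atom a)) → I ⊨ atom a → Red J I (atom a)
            Red-∨¬⇒atom (_ , true , ra)   _  = ra
            Red-∨¬⇒atom (_ , false , r¬a) Ia = ⊥-elim (proj₁ r¬a Ia)

        from′ : Red J I ((F ∧' ¬' (¬' (atom a))) ⇒ atom a) →
                Red J I (F ⇒ (atom a ∨' ¬' (atom a)))
        from′ (_ , r) = (λ _ → atom-excluded-middle I a) , λ rF →
          atom-excluded-middle I a , Red-∨¬-cases rF (atom? I a)
          where
            Red-¬¬ : I ⊨ atom a → Red J I (¬' (¬' (atom a)))
            Red-¬¬ Ia = (λ ¬a → ¬a Ia) , λ r¬a → ⊥-elim (proj₁ r¬a Ia)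

            Red-∨¬-cases : Red J I F → Dec (I ⊨ atom a) →
                              Σ Bool λ c → Red J I (if c then atom a else ¬' (atom a))
            Red-∨¬-cases rF (yes Ia) = true , r
              ( (λ { true → Red⇒⊨ F rF ; false → proj₁ (Red-¬¬ Ia) })
              , λ { true → rF ; false → Red-¬¬ Ia })
            Red-∨¬-cases rF (no ¬Ia) = false , ¬Ia , λ ra → ⊥-elim (¬Ia (proj₁ ra))

    SplitReduct : Rule → Set
    SplitReduct (h ⇐ bs) =
      (∀ i → Red J I (τ₁comp h bs i)) × (IsConstraint h → I ⊨ ¬' (τBody bs))

    Red-τR : ∀ R → Red J I (τR R) ⇔ SplitReduct R
    Red-τR (basic (p ⦅ ts ⦆) ⇐ bs) = mk⇔
      (λ r → to (Red-⇒⋀ (τBody bs) _) r , λ ())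
      (λ (r , _) → from (Red-⇒⋀ (τBody bs) _) r)
    Red-τR (choice (p ⦅ ts ⦆) ⇐ bs) = mk⇔
      (λ r → (λ i → to (Red-choice (τBody bs) _) (to (Red-⇒⋀ (τBody bs) _) r i)) , λ ())
      (λ (r , _) → from (Red-⇒⋀ (τBody bs) _) λ i → from (Red-choice (τBody bs) _) (r i))
    Red-τR (none ⇐ bs) = mk⇔
      (λ r → (λ ()) , λ _ → to (Red-¬ (τBody bs)) r)
      (λ (_ , c) → from (Red-¬ (τBody bs)) (c tt))

    Red-τΓ : ∀ Γ → Red J I (τΓ Γ) ⇔ (Red J I (τ₁ Γ) × I ⊨ τ₂ Γ)
    Red-τΓ Γ = mk⇔
      (λ r → from (Red-⋀ _) (λ (k , i) → proj₁ (split r k) i)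
           , λ (k , c) → proj₂ (split r k) c)
      (λ (r₁ , ⊨τ₂) → from (Red-⋀ _) λ k →
         from (Red-τR (instOf {Γ} k)) ((λ i → to (Red-⋀ _) r₁ (k , i)) , λ c → ⊨τ₂ (k , c)))
      where
        split : Red J I (τΓ Γ) → ∀ k → SplitReduct (instOf {Γ} k)
        split r k = to (Red-τR (instOf {Γ} k)) (to (Red-⋀ _) r k)

  StableModel-cong : ∀ {F G C I} → (∀ {J} → Red J I F ⇔ (Red J I G × I ⊨ C)) →
                     StableModel F I ⇔ (StableModel G I × I ⊨ C)
  StableModel-cong {I = I} Red-F = mk⇔
    (λ (rI , min) → let (rG , ⊨C) = to Red-F rI in
       (rG , λ J J⊆I rJ → min J J⊆I (from Red-F (rJ , ⊨C))) , ⊨C)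
    (λ ((rG , min) , ⊨C) →
       from Red-F (rG , ⊨C) , λ J J⊆I rJ → min J J⊆I (proj₁ (to Red-F rJ)))

lemma4 : (S : Signature) (Γ : Lang.Program S) (I : Lang.Interp S) →
         Lang.StableModelΓ S Γ I ⇔
         (Lang.InVoc S Γ I × Lang.StableModel S (Lang.τ₁ S Γ) I ×
          Lang._⊨_ S I (Lang.τ₂ S Γ))
lemma4 S Γ I = ⇔-refl ×-⇔ StableModel-cong S {F = τΓ Γ} {G = τ₁ Γ} {C = τ₂ Γ} (Red-τΓ S Γ)
  where open Lang S
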